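{- Let $\alpha$, $\beta$, $\sigma$ be vincular patterns. If $\alpha$ and $\beta$ are filling-shape-Wilf-equivalent, then $\alpha\oplus\sigma$ and $\beta\oplus\sigma$ are filling-shape-Wilf-equivalent.
   Context: A vincular pattern of length $k$ is a pair $(\sigma,X)$ with $\sigma\in S_k$ and $X\subseteq[k-1]$. It is written as $\sigma$ with a dash between $\sigma_j$ and $\sigma_{j+1}$ exactly when $j\notin X$. Direct sum: for $(\sigma,A)$ of length $k$ and $(\tau,B)$ of length $\ell$, $(\sigma,A)\oplus(\tau,B)=(\sigma_1\cdots\sigma_k(\tau_1+k)\cdots(\tau_\ell+k),\ A\cup\{i+k:i\in B\})$. A Young board $\lambda=(\lambda_1,\dots,\lambda_n)$ with $\lambda_1\ge\dots\ge\lambda_n>0$ is the cell set $\{(i,j):1\le i\le n,\ 1\le j\le\lambda_i\}$, with width $n$ and height $\lambda_1$. A filling is a $0/1$ assignment to the cells with at most one $1$ per row and per column. It is encoded by the word $\pi_1\cdots\pi_n$ with $\pi_c=r$ if $(c,r)$ holds a $1$ and $\pi_c=\square$ if column $c$ is empty. A filling $\pi$ contains $(\sigma,X)$ if there are $i_1<\dots<i_k$ such that all of the following hold: - all $\pi_{i_j}$ are numbers; - $\pi_{i_1}\cdots\pi_{i_k}$ is order-isomorphic to $\sigma$; - $i_{j+1}=i_j+1$ for $j\in X$; - the cell $(i_k,\max_j\pi_{i_j})$ lies in $\lambda$. Otherwise $\pi$ avoids $(\sigma,X)$. $\mathcal{S}_\lambda^{C,R}(\sigma)$ denotes the set of fillings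 of $\lambda$ with empty columns exactly $C$ and empty rows exactly $R$ that avoid $\sigma$. Two vincular patterns $\sigma,\tau$ are filling-shape-Wilf-equivalent if $|\mathcal{S}_\lambda^{C,R}(\sigma)|=|\mathcal{S}_\lambda^{C,R}(\tau)|$ for all Young boards $\lambda$ and all $C\subseteq[\text{width}(\lambda)]$, $R\subseteq[\text{height}(\lambda)]$. -}

module Defs where

open import Data.Nat using (ℕ; zero; suc; _+_; _<_; _≤_; _≥_)
open import Data.Fin as F using (Fin; toℕ; inject₁; _↑ˡ_; _↑ʳ_; splitAt; join)
open import Data.Fin.Properties using (splitAt-join; join-splitAt)
open import Data.Fin.Subset using (Subset; _∈_)
open import Data.Vec using (Vec; []; _∷_; _++_; lookup)
open import Data.Maybe using (Maybe; just; nothing)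
open import Data.Sum using (_⊎_; inj₁; inj₂)
import Data.Sum as Sum
open import Data.Bool using (Bool; true; false)
open import Data.Product using (Σ; ∃; ∃-syntax; _×_; _,_; proj₁)
open import Data.Empty using (⊥)
open import Relation.Nullary using (¬_)
open import Relation.Binary.PropositionalEquality using (_≡_; refl; cong; trans; sym; isEquivalence)
open import Relation.Binary.Bundles using (Setoid)
open import Function.Definitions using (Injective)
open import Function.Bundles using (Inverse)
open import Function using (_⇔_; _∘_)

-- Vincular patterns (of length k = suc m ≥ 1), 0-indexed internally.
-- perm : Fin k → Fin k is an injective (hence bijective) map, i.e. σ ∈ S_k
--   (σ_{j+1} = perm j + 1).
-- gaps : Subset m  (m = k - 1); gap g ∈ gaps  means  g+1 ∈ X,
--   i.e. positions g and g+1 (0-indexed) must be adjacent.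

record Pattern : Set where
  field
    m        : ℕ
    perm     : Fin (suc m) → Fin (suc m)
    perm-inj : Injective _≡_ _≡_ perm
    gaps     : Subset m

open Pattern public

⊕-perm : ∀ {a b} → (Fin (suc a) → Fin (suc a)) → (Fin (suc b) → Fin (suc b))
       → Fin (suc a + suc b) → Fin (suc a + suc b)
⊕-perm {a} {b} σ τ x = join (suc a) (suc b) (Sum.map σ τ (splitAt (suc a) x))

private
  inj₁-inj : ∀ {A B : Set} {x y : A} → inj₁ {B = B} x ≡ inj₁ y → x ≡ y
  inj₁-inj refl = refl
  inj₂-inj : ∀ {A B : Set} {x y : B} → inj₂ {A = A} x ≡ inj₂ y → x ≡ y
  inj₂-inj refl = refl

  map-inj : ∀ {A B : Set} {f : A → A} {g : B → B} →
            Injective _≡_ _≡_ f → Injective _≡_ _≡_ g →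
            Injective _≡_ _≡_ (Sum.map f g)
  map-inj fi gi {inj₁ x} {inj₁ y} e = cong inj₁ (fi (inj₁-inj e))
  map-inj fi gi {inj₁ x} {inj₂ y} ()
  map-inj fi gi {inj₂ x} {inj₁ y} ()
  map-inj fi gi {inj₂ x} {inj₂ y} e = cong inj₂ (gi (inj₂-inj e))

⊕-perm-inj : ∀ {a b} (σ : Fin (suc a) → Fin (suc a)) (τ : Fin (suc b) → Fin (suc b))
           → Injective _≡_ _≡_ σ → Injective _≡_ _≡_ τ
           → Injective _≡_ _≡_ (⊕-perm σ τ)
⊕-perm-inj {a} {b} σ τ si ti {x} {y} e =
  trans (sym (join-splitAt (suc a) (suc b) x))
    (trans (cong (join (suc a) (suc b)) s≡)
           (join-splitAt (suc a) (suc b) y))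
  where
    e' = trans (sym (splitAt-join (suc a) (suc b) (Sum.map σ τ (splitAt (suc a) x))))
           (trans (cong (splitAt (suc a)) e)
                  (splitAt-join (suc a) (suc b) (Sum.map σ τ (splitAt (suc a) y))))
    s≡ = map-inj si ti {splitAt (suc a) x} {splitAt (suc a) y} e'

_⊕_ : Pattern → Pattern → Pattern
p ⊕ q = record
  { m        = m p + suc (m q)
  ; perm     = ⊕-perm (perm p) (perm q)
  ; perm-inj = ⊕-perm-inj (perm p) (perm q) (perm-inj p) (perm-inj q)
  -- A ∪ {i + k : i ∈ B}; the gap between σ_k and τ_1 is a dash.
  ; gaps     = gaps p ++ (false ∷ gaps q)
  }

-- Young boards: n columns, column c (0-indexed) has height col c,
-- weakly decreasing and positive.  Cells: (c , r) with r < col c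
-- (rows 0-indexed, row r here is row r+1 in the paper).

record Board : Set where
  field
    n      : ℕ
    col    : Fin n → ℕ
    col-dec : ∀ (c d : Fin n) → c F.≤ d → col d ≤ col c
    col-pos : ∀ (c : Fin n) → 0 < col c

open Board public

height : Board → ℕ
height B with n B | col B
... | zero  | _ = 0
... | suc _ | h = h F.zero

-- A filling: word π, entry nothing = empty column (□), just r = the 1 in row r.
record IsFilling (B : Board) (π : Vec (Maybe ℕ) (n B)) : Set where
  field
    inBoard  : ∀ c r → lookup π c ≡ just r → r < col B c
    rowUnique : ∀ c d r → lookup π c ≡ just r → lookup π d ≡ just r → c ≡ d

EmptyColsExactly : (B : Board) → Vec (Maybe ℕ) (n B) → Subset (n B) → Set
EmptyColsExactly B π C = ∀ c → (c ∈ C) ⇔ (lookup π c ≡ nothing)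

EmptyRowsExactly : (B : Board) → Vec (Maybe ℕ) (n B) → Subset (height B) → Set
EmptyRowsExactly B π R = ∀ (r : Fin (height B)) → (r ∈ R) ⇔ (¬ (∃[ c ] lookup π c ≡ just (toℕ r)))

-- An occurrence: positions i₀ < … < i_{k-1}
-- (strictly increasing), all entries numbers (values v), order-isomorphic
-- to perm, adjacency for the gaps, and the cell (i_{k-1}, max v) in B,
-- i.e. max v < col (i_{k-1}), which we write as ∀ j → v j < col (i_{k-1}).
record Occurrence (B : Board) (π : Vec (Maybe ℕ) (n B)) (p : Pattern) : Set where
  field
    pos     : Fin (suc (m p)) → Fin (n B)
    pos-inc : ∀ a b → a F.< b → pos a F.< pos b
    val     : Fin (suc (m p)) → ℕ
    val-ok  : ∀ j → lookup π (pos j) ≡ just (val j)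
    iso     : ∀ a b → (val a < val b) ⇔ (perm p a F.< perm p b)
    adj     : ∀ (g : Fin (m p)) → g ∈ gaps p →
                toℕ (pos (F.suc g)) ≡ suc (toℕ (pos (inject₁ g)))
    cell    : ∀ j → val j < col B (pos (F.fromℕ (m p)))

Contains : (B : Board) → Vec (Maybe ℕ) (n B) → Pattern → Set
Contains B π p = Occurrence B π p

AvoidingFillings : (B : Board) → Subset (n B) → Subset (height B) → Pattern → Setoid _ _
AvoidingFillings B C R p = record
  { Carrier = Σ (Vec (Maybe ℕ) (n B)) (λ π →
                IsFilling B π × EmptyColsExactly B π C × EmptyRowsExactly B π R
                × ¬ Contains B π p)
  ; _≈_ = λ x y → proj₁ x ≡ proj₁ y
  ; isEquivalence = record { refl = refl ; sym = sym ; trans = trans }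
  }

-- |S_λ^{C,R}(p)| = |S_λ^{C,R}(q)|, expressed as a bijection of the sets.
FillingShapeWilfEquiv : Pattern → Pattern → Set
FillingShapeWilfEquiv p q =
  ∀ (B : Board) (C : Subset (n B)) (R : Subset (height B)) →
    Inverse (AvoidingFillings B C R p) (AvoidingFillings B C R q)

module Submission where

-- Fix a board B and a filling π of B.  Call a cell (c , j) σ-shadowed in π when π has
-- an occurrence of σ lying strictly to the right of column c and strictly above row j.
-- The shadowed cells form a Young board G(π) (column c has height h(c), weakly
-- decreasing in c), and the shadowed entries of π form a filling π⁺ of G(π).  Because
-- every entry of a (τ ⊕ σ)-occurrence belonging to τ is shadowed by the σ-part,
--   (1) π contains τ ⊕ σ  iff  π⁺ contains τ  (in G(π)).
-- The shadow is determined by the entries outside it: a shadowed cell is always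
-- witnessed by a σ-occurrence consisting of unshadowed entries.  Hence
--   (2) replacing π⁺ inside G(π) by any filling ρ with the same empty rows and columns
--       yields a filling π' of B with the same empty rows and columns and G(π') = G(π).
-- Feeding π⁺ through the given bijection S(α) ≅ S(β) on G(π) and replacing gives the
-- map S(α ⊕ σ) → S(β ⊕ σ); by (1), (2) the two directions are mutually inverse.
-- For Agda's Board the shadow board is stored with every column one cell higher
-- (heights must be positive), so π⁺ is shifted up by one row.

open import Defs

open import Data.Nat as ℕ using (ℕ; zero; suc; _+_; _<_; _≤_; z≤n; s≤s; s≤s⁻¹; _≤?_; _<?_)
import Data.Nat.Properties as ℕₚ
open import Data.Fin as F using (Fin; toℕ; inject₁; fromℕ; _↑ˡ_; _↑ʳ_; splitAt)
import Data.Fin.Properties as Fₚ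
open import Data.Fin.Subset using (Subset; _∈_)
open import Data.Fin.Subset.Properties using (_∈?_)
open import Data.Vec using (Vec; _∷_; _++_; lookup; tabulate)
import Data.Vec.Properties as Vₚ
open import Data.Maybe using (Maybe; just; nothing; fromMaybe)
open import Data.Maybe.Properties as Mₚ using (just-injective)
open import Data.Bool using (Bool; true; false)
open import Data.Bool.Properties using (T-irrelevant)
open import Data.Product using (Σ; ∃; _×_; _,_; proj₁; proj₂)
open import Data.Sum using (inj₁; inj₂; [_,_]′)
open import Data.Empty using (⊥; ⊥-elim)
open import Relation.Nullary using (¬_; Dec; yes; no)
open import Relation.Nullary.Decidable using (True; toWitness; fromWitness; ⌊_⌋; ¬?; _×-dec_; _→-dec_; map′)
open import Relation.Unary using (Decidable)
open import Relation.Binary.PropositionalEquality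
open import Relation.Binary.Bundles using (Setoid)
open import Function.Bundles using (Inverse; Equivalence; mk⇔)
open import Function using (_⇔_; _∘_)
open Equivalence using (to; from)
open Occurrence

prefixLength : {P : ℕ → Set} → Decidable P → ℕ → ℕ
prefixLength P? zero = zero
prefixLength P? (suc N) with P? 0
... | yes _ = suc (prefixLength (λ x → P? (suc x)) N)
... | no _  = zero

prefixLength-sound : {P : ℕ → Set} (P? : Decidable P) (N : ℕ) →
                     ∀ j → j < prefixLength P? N → P j
prefixLength-sound P? (suc N) j lt with P? 0
prefixLength-sound P? (suc N) zero    _          | yes p = p
prefixLength-sound P? (suc N) (suc j) (s≤s lt)   | yes _ = prefixLength-sound (λ x → P? (suc x)) N j lt

prefixLength-complete : {P : ℕ → Set} (P? : Decidable P) → (∀ {i j} → i ≤ j → P j → P i) →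
                        ∀ N j → j < N → P j → j < prefixLength P? N
prefixLength-complete P? down (suc N) zero _ p0 with P? 0
... | yes _  = s≤s z≤n
... | no ¬p0 = ⊥-elim (¬p0 p0)
prefixLength-complete P? down (suc N) (suc j) (s≤s j<N) pj with P? 0
... | yes _  = s≤s (prefixLength-complete (λ x → P? (suc x)) (λ i≤j → down (s≤s i≤j)) N j j<N pj)
... | no ¬p0 = ⊥-elim (¬p0 (down z≤n pj))

prefixLength-cong : {P Q : ℕ → Set} (P? : Decidable P) (Q? : Decidable Q) (N : ℕ) →
                    (∀ x → P x → Q x) → (∀ x → Q x → P x) → prefixLength P? N ≡ prefixLength Q? N
prefixLength-cong P? Q? zero f g = refl
prefixLength-cong P? Q? (suc N) f g with P? 0 | Q? 0
... | yes _  | yes _  = cong suc (prefixLength-cong (λ x → P? (suc x)) (λ x → Q? (suc x)) N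
                                    (λ x → f (suc x)) (λ x → g (suc x)))
... | yes p  | no ¬q  = ⊥-elim (¬q (f 0 p))
... | no ¬p  | yes q  = ⊥-elim (¬p (g 0 q))
... | no _   | no _   = refl

cons : ∀ {k} {A : Set} → A → (Fin k → A) → Fin (suc k) → A
cons x g F.zero    = x
cons x g (F.suc i) = g i

PointwiseInvariant : ∀ {k n} → ((Fin k → Fin n) → Set) → Set
PointwiseInvariant {k} {n} P = ∀ (f g : Fin k → Fin n) → (∀ a → f a ≡ g a) → P f → P g

searchMaps : ∀ k {n} (P : (Fin k → Fin n) → Set) → PointwiseInvariant P →
             (∀ f → Dec (P f)) → Dec (Σ (Fin k → Fin n) P)
searchMaps zero P inv P? with P? (λ ())
... | yes p  = yes ((λ ()) , p)
... | no ¬p  = no λ { (f , pf) → ¬p (inv f (λ ()) (λ ()) pf) }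
searchMaps (suc k) {n} P inv P? with Fₚ.any? (λ x →
    searchMaps k (P ∘ cons x)
      (λ f g e → inv (cons x f) (cons x g) (λ { F.zero → refl ; (F.suc i) → e i }))
      (P? ∘ cons x))
... | yes (x , g , p) = yes (cons x g , p)
... | no ¬p = no λ { (f , pf) → ¬p (f F.zero , (λ i → f (F.suc i)) ,
                       inv f _ (λ { F.zero → refl ; (F.suc i) → refl }) pf) }

dec⇔ : {A B : Set} → Dec A → Dec B → Dec (A ⇔ B)
dec⇔ a? b? = map′ (λ (f , g) → mk⇔ f g) (λ e → to e , from e) ((a? →-dec b?) ×-dec (b? →-dec a?))

vec-ext : ∀ {A : Set} {k} (u v : Vec A k) → (∀ c → lookup u c ≡ lookup v c) → u ≡ v
vec-ext u v h = trans (sym (Vₚ.tabulate∘lookup u)) (trans (Vₚ.tabulate-cong h) (Vₚ.tabulate∘lookup v))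

argmax : ∀ {k} (f : Fin (suc k) → ℕ) → Σ (Fin (suc k)) λ a → ∀ x → f x ≤ f a
argmax {zero} f = F.zero , λ { F.zero → ℕₚ.≤-refl }
argmax {suc k} f with argmax (f ∘ F.suc)
... | a , p with ℕₚ.≤-total (f F.zero) (f (F.suc a))
... | inj₁ le = F.suc a , λ { F.zero → le ; (F.suc x) → p x }
... | inj₂ ge = F.zero  , λ { F.zero → ℕₚ.≤-refl ; (F.suc x) → ℕₚ.≤-trans (p x) ge }

Decreasing : ∀ {n} → Vec ℕ n → Set
Decreasing w = ∀ c d → c F.≤ d → lookup w d ≤ lookup w c

decreasing? : ∀ {n} (w : Vec ℕ n) → Dec (Decreasing w)
decreasing? w = Fₚ.all? λ c → Fₚ.all? λ d → (c Fₚ.≤? d) →-dec (lookup w d ≤? lookup w c)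

-- The proof of decreasingness is an element of the proof-irrelevant type True, so the
-- board depends on w alone (see transport-along-board below).
boardOf : ∀ {n} (w : Vec ℕ n) → True (decreasing? w) → Board
boardOf {n} w ok = record
  { n       = n
  ; col     = λ c → suc (lookup w c)
  ; col-dec = λ c d le → s≤s (toWitness ok c d le)
  ; col-pos = λ c → s≤s z≤n
  }

rowOfCell : (G : Board) (c : Fin (n G)) (r : ℕ) → r < col G c →
            Σ (Fin (height G)) λ r' → toℕ r' ≡ r
rowOfCell record { n = zero } () r lt
rowOfCell record { n = suc k ; col-dec = cd } c r lt =
  F.fromℕ< (ℕₚ.<-≤-trans lt (cd F.zero c z≤n)) , Fₚ.toℕ-fromℕ< _

Occupied : ∀ {N} → Vec (Maybe ℕ) N → ℕ → Set
Occupied π r = ∃ λ c → lookup π c ≡ just r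

occupied? : ∀ {N} (π : Vec (Maybe ℕ) N) r → Dec (Occupied π r)
occupied? π r = Fₚ.any? (λ c → Mₚ.≡-dec ℕ._≟_ (lookup π c) (just r))

isNothing : Maybe ℕ → Bool
isNothing nothing  = true
isNothing (just _) = false

emptyColumns : ∀ {N} → Vec (Maybe ℕ) N → Subset N
emptyColumns π = tabulate (λ c → isNothing (lookup π c))

emptyRows : (G : Board) → Vec (Maybe ℕ) (n G) → Subset (height G)
emptyRows G π = tabulate (λ r → ⌊ ¬? (occupied? π (toℕ r)) ⌋)

∈-tabulate : ∀ {N} (f : Fin N → Bool) x → x ∈ tabulate f ⇔ f x ≡ true
∈-tabulate f x = mk⇔ (λ m → trans (sym (Vₚ.lookup∘tabulate f x)) (Vₚ.[]=⇒lookup m))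
                      (λ e → Vₚ.lookup⇒[]= x _ (trans (Vₚ.lookup∘tabulate f x) e))

emptyColumns-exact : (G : Board) (π : Vec (Maybe ℕ) (n G)) → EmptyColsExactly G π (emptyColumns π)
emptyColumns-exact G π c = mk⇔ (λ m → isNothing-sound (lookup π c) (to (∈-tabulate _ c) m))
                                (λ e → from (∈-tabulate _ c) (isNothing-complete e))
  where
    isNothing-sound : ∀ x → isNothing x ≡ true → x ≡ nothing
    isNothing-sound nothing _ = refl
    isNothing-complete : ∀ {x} → x ≡ nothing → isNothing x ≡ true
    isNothing-complete refl = refl

emptyRows-exact : (G : Board) (π : Vec (Maybe ℕ) (n G)) → EmptyRowsExactly G π (emptyRows G π)
emptyRows-exact G π r = mk⇔ (λ m → sound (to (∈-tabulate _ r) m)) (λ ne → from (∈-tabulate _ r) (complete ne))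
  where
    sound : ⌊ ¬? (occupied? π (toℕ r)) ⌋ ≡ true → ¬ Occupied π (toℕ r)
    sound e with occupied? π (toℕ r)
    ... | no ¬o = ¬o
    complete : ¬ Occupied π (toℕ r) → ⌊ ¬? (occupied? π (toℕ r)) ⌋ ≡ true
    complete ne with occupied? π (toℕ r)
    ... | yes o = ⊥-elim (ne o)
    ... | no _  = refl

subset-ext : ∀ {N} (S T : Subset N) → (∀ x → x ∈ S ⇔ x ∈ T) → S ≡ T
subset-ext S T h = vec-ext S T pointwise
  where
    pointwise : ∀ x → lookup S x ≡ lookup T x
    pointwise x with lookup S x in eS | lookup T x in eT
    ... | true  | true  = refl
    ... | false | false = refl
    ... | true  | false = sym (trans (sym eT) (Vₚ.[]=⇒lookup (to (h x) (Vₚ.lookup⇒[]= x S eS))))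
    ... | false | true  = trans (sym eS) (Vₚ.[]=⇒lookup (from (h x) (Vₚ.lookup⇒[]= x T eT)))

emptyColumns-unique : (G : Board) (π : Vec (Maybe ℕ) (n G)) (C : Subset (n G)) →
                      EmptyColsExactly G π C → C ≡ emptyColumns π
emptyColumns-unique G π C h = subset-ext _ _ λ x →
  mk⇔ (λ m → from (emptyColumns-exact G π x) (to (h x) m))
      (λ m → from (h x) (to (emptyColumns-exact G π x) m))

emptyRows-unique : (G : Board) (π : Vec (Maybe ℕ) (n G)) (R : Subset (height G)) →
                   EmptyRowsExactly G π R → R ≡ emptyRows G π
emptyRows-unique G π R h = subset-ext _ _ λ x →
  mk⇔ (λ m → from (emptyRows-exact G π x) (to (h x) m))
      (λ m → from (h x) (to (emptyRows-exact G π x) m))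

sameEmptyRows-occupied : (G : Board) (ρ π : Vec (Maybe ℕ) (n G)) (R : Subset (height G)) →
  IsFilling G ρ → EmptyRowsExactly G ρ R → EmptyRowsExactly G π R → ∀ r → Occupied ρ r → Occupied π r
sameEmptyRows-occupied G ρ π R fillρ eρ eπ r (c , e) with rowOfCell G c r (IsFilling.inBoard fillρ c r e)
... | r' , refl with occupied? π (toℕ r')
... | yes o  = o
... | no ¬o  = ⊥-elim (to (eρ r') (from (eπ r') ¬o) (c , e))

module SumIndex (a b : ℕ) where
  L : Fin (suc a) → Fin (suc a + suc b)
  L x = x ↑ˡ suc b
  R : Fin (suc b) → Fin (suc a + suc b)
  R y = suc a ↑ʳ y

  perm-L : ∀ (s : Fin (suc a) → Fin (suc a)) (t : Fin (suc b) → Fin (suc b)) x → ⊕-perm s t (L x) ≡ L (s x)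
  perm-L s t x rewrite Fₚ.splitAt-↑ˡ (suc a) x (suc b) = refl
  perm-R : ∀ (s : Fin (suc a) → Fin (suc a)) (t : Fin (suc b) → Fin (suc b)) y → ⊕-perm s t (R y) ≡ R (t y)
  perm-R s t y rewrite Fₚ.splitAt-↑ʳ (suc a) (suc b) y = refl

  toℕ-L : ∀ x → toℕ (L x) ≡ toℕ x
  toℕ-L x = Fₚ.toℕ-↑ˡ x (suc b)
  toℕ-R : ∀ y → toℕ (R y) ≡ suc a + toℕ y
  toℕ-R y = Fₚ.toℕ-↑ʳ (suc a) y

  L<L : ∀ x y → (L x F.< L y) ⇔ (x F.< y)
  L<L x y = mk⇔ (subst₂ _<_ (toℕ-L x) (toℕ-L y)) (subst₂ _<_ (sym (toℕ-L x)) (sym (toℕ-L y)))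
  R<R : ∀ x y → (R x F.< R y) ⇔ (x F.< y)
  R<R x y = mk⇔ (λ lt → ℕₚ.+-cancelˡ-< (suc a) _ _ (subst₂ _<_ (toℕ-R x) (toℕ-R y) lt))
                (λ lt → subst₂ _<_ (sym (toℕ-R x)) (sym (toℕ-R y)) (ℕₚ.+-monoʳ-< (suc a) lt))
  L<R : ∀ x y → L x F.< R y
  L<R x y = subst₂ _<_ (sym (toℕ-L x)) (sym (toℕ-R y))
              (ℕₚ.<-≤-trans (Fₚ.toℕ<n x) (ℕₚ.m≤m+n (suc a) (toℕ y)))
  R≮L : ∀ x y → ¬ (R y F.< L x)
  R≮L x y lt = ℕₚ.<-asym lt (L<R x y)

  L≤lastL : ∀ x → L x F.≤ L (fromℕ a)
  L≤lastL x = subst₂ _≤_ (sym (toℕ-L x)) (sym (toℕ-L (fromℕ a))) (Fₚ.≤fromℕ x)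

  last≡lastR : fromℕ (a + suc b) ≡ R (fromℕ b)
  last≡lastR = Fₚ.toℕ-injective (begin
    toℕ (fromℕ (a + suc b))  ≡⟨ Fₚ.toℕ-fromℕ _ ⟩
    a + suc b                ≡⟨ ℕₚ.+-suc a b ⟩
    suc (a + b)              ≡⟨ cong (λ k → suc (a + k)) (sym (Fₚ.toℕ-fromℕ b)) ⟩
    suc a + toℕ (fromℕ b)    ≡⟨ sym (toℕ-R (fromℕ b)) ⟩
    toℕ (R (fromℕ b))        ∎)
    where open ≡-Reasoning

  data View : Fin (suc a + suc b) → Set where
    isL : ∀ x → View (L x)
    isR : ∀ y → View (R y)

  view : ∀ z → View z
  view z with splitAt (suc a) z in eq
  ... | inj₁ x = subst View (Fₚ.splitAt⁻¹-↑ˡ eq) (isL x)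
  ... | inj₂ y = subst View (Fₚ.splitAt⁻¹-↑ʳ eq) (isR y)

  data GapView : Fin (a + suc b) → Set where
    gapL    : ∀ g → GapView (g ↑ˡ suc b)
    gapJoin : GapView (a ↑ʳ F.zero)
    gapR    : ∀ g → GapView (a ↑ʳ F.suc g)

  gapView : ∀ z → GapView z
  gapView z with splitAt a z in eq
  ... | inj₁ x         = subst GapView (Fₚ.splitAt⁻¹-↑ˡ eq) (gapL x)
  ... | inj₂ F.zero    = subst GapView (Fₚ.splitAt⁻¹-↑ʳ eq) gapJoin
  ... | inj₂ (F.suc g) = subst GapView (Fₚ.splitAt⁻¹-↑ʳ eq) (gapR g)

  inject-gapL : ∀ (g : Fin a) → inject₁ (g ↑ˡ suc b) ≡ L (inject₁ g)
  inject-gapL g = Fₚ.toℕ-injective (begin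
    toℕ (inject₁ (g ↑ˡ suc b))  ≡⟨ Fₚ.toℕ-inject₁ _ ⟩
    toℕ (g ↑ˡ suc b)            ≡⟨ Fₚ.toℕ-↑ˡ g (suc b) ⟩
    toℕ g                       ≡⟨ sym (Fₚ.toℕ-inject₁ g) ⟩
    toℕ (inject₁ g)             ≡⟨ sym (toℕ-L _) ⟩
    toℕ (L (inject₁ g))         ∎)
    where open ≡-Reasoning

  inject-gapR : ∀ (g : Fin b) → inject₁ (a ↑ʳ F.suc g) ≡ R (inject₁ g)
  inject-gapR g = Fₚ.toℕ-injective (begin
    toℕ (inject₁ (a ↑ʳ F.suc g))  ≡⟨ Fₚ.toℕ-inject₁ _ ⟩
    toℕ (a ↑ʳ F.suc g)            ≡⟨ Fₚ.toℕ-↑ʳ a (F.suc g) ⟩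
    a + suc (toℕ g)               ≡⟨ ℕₚ.+-suc a (toℕ g) ⟩
    suc a + toℕ g                 ≡⟨ cong (suc a +_) (sym (Fₚ.toℕ-inject₁ g)) ⟩
    suc a + toℕ (inject₁ g)       ≡⟨ sym (toℕ-R _) ⟩
    toℕ (R (inject₁ g))           ∎)
    where open ≡-Reasoning

  gaps-L : ∀ {A : Set} (xs : Vec A a) (y : A) (ys : Vec A b) g → lookup (xs ++ (y ∷ ys)) (g ↑ˡ suc b) ≡ lookup xs g
  gaps-L xs y ys g = Vₚ.lookup-++ˡ xs (y ∷ ys) g
  gaps-join : ∀ {A : Set} (xs : Vec A a) (y : A) (ys : Vec A b) → lookup (xs ++ (y ∷ ys)) (a ↑ʳ F.zero) ≡ y
  gaps-join xs y ys = Vₚ.lookup-++ʳ xs (y ∷ ys) F.zero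
  gaps-R : ∀ {A : Set} (xs : Vec A a) (y : A) (ys : Vec A b) g → lookup (xs ++ (y ∷ ys)) (a ↑ʳ F.suc g) ≡ lookup ys g
  gaps-R xs y ys g = Vₚ.lookup-++ʳ xs (y ∷ ys) (F.suc g)

pos-mono : ∀ {B π p} (O : Occurrence B π p) x y → x F.≤ y → pos O x F.≤ pos O y
pos-mono O x y le with ℕₚ.m≤n⇒m<n∨m≡n le
... | inj₁ lt = ℕₚ.<⇒≤ (pos-inc O x y lt)
... | inj₂ eq = ℕₚ.≤-reflexive (cong (toℕ ∘ pos O) (Fₚ.toℕ-injective eq))

transport-occurrence : ∀ {B : Board} {π π' : Vec (Maybe ℕ) (n B)} {τ : Pattern} (O : Occurrence B π τ) →
  (∀ a → lookup π' (pos O a) ≡ just (val O a)) → Occurrence B π' τ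
transport-occurrence O e = record { pos = pos O ; pos-inc = pos-inc O ; val = val O ; val-ok = e
                                  ; iso = iso O ; adj = adj O ; cell = cell O }

module Shadow (σ : Pattern) (B : Board) where

  N = n B
  Word = Vec (Maybe ℕ) N
  K = suc (m σ)

  NorthEastOf : ∀ {π} → Occurrence B π σ → Fin N → ℕ → Set
  NorthEastOf O c j = (∀ a → c F.< pos O a) × (∀ a → j < val O a)

  Shadowed : Word → Fin N → ℕ → Set
  Shadowed π c j = Σ (Occurrence B π σ) λ O → NorthEastOf O c j

  shadowed-down : ∀ {π c j c' j'} → Shadowed π c j → c' F.≤ c → j' ≤ j → Shadowed π c' j'
  shadowed-down (O , right , above) c'≤c j'≤j =
    O , (λ a → ℕₚ.≤-<-trans c'≤c (right a)) , (λ a → ℕₚ.≤-<-trans j'≤j (above a))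

  -- A shadowed cell lies in the board: it is below the highest entry of the occurrence,
  -- whose last column is to the right of c.
  shadowed-inBoard : ∀ {π c j} → Shadowed π c j → j < col B c
  shadowed-inBoard (O , right , above) =
    ℕₚ.<-≤-trans (ℕₚ.<-trans (above last) (cell O last)) (col-dec B _ (pos O last) (ℕₚ.<⇒≤ (right last)))
    where last = fromℕ (m σ)

  -- Shadowedness is decidable: an occurrence is determined by its position map, so it
  -- suffices to search all maps Fin K → Fin N.
  module Decide where
    valueAt : Word → (Fin K → Fin N) → Fin K → ℕ
    valueAt π f a = fromMaybe 0 (lookup π (f a))

    IsNorthEastOccurrence : Word → Fin N → ℕ → (Fin K → Fin N) → Set
    IsNorthEastOccurrence π c j f =
      (∀ a b → a F.< b → f a F.< f b) ×
      (∀ a → lookup π (f a) ≡ just (valueAt π f a)) ×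
      (∀ a b → (valueAt π f a < valueAt π f b) ⇔ (perm σ a F.< perm σ b)) ×
      (∀ g → g ∈ gaps σ → toℕ (f (F.suc g)) ≡ suc (toℕ (f (inject₁ g)))) ×
      (∀ a → valueAt π f a < col B (f (fromℕ (m σ)))) ×
      (∀ a → c F.< f a) ×
      (∀ a → j < valueAt π f a)

    isNorthEastOccurrence? : ∀ π c j f → Dec (IsNorthEastOccurrence π c j f)
    isNorthEastOccurrence? π c j f =
      Fₚ.all? (λ a → Fₚ.all? λ b → (a Fₚ.<? b) →-dec (f a Fₚ.<? f b)) ×-dec
      Fₚ.all? (λ a → Mₚ.≡-dec ℕ._≟_ (lookup π (f a)) (just (valueAt π f a))) ×-dec
      Fₚ.all? (λ a → Fₚ.all? λ b → dec⇔ (valueAt π f a <? valueAt π f b) (perm σ a Fₚ.<? perm σ b)) ×-dec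
      Fₚ.all? (λ g → (g ∈? gaps σ) →-dec (toℕ (f (F.suc g)) ℕ.≟ suc (toℕ (f (inject₁ g))))) ×-dec
      Fₚ.all? (λ a → valueAt π f a <? col B (f (fromℕ (m σ)))) ×-dec
      Fₚ.all? (λ a → c Fₚ.<? f a) ×-dec
      Fₚ.all? (λ a → j <? valueAt π f a)

    isNorthEastOccurrence-invariant : ∀ π c j → PointwiseInvariant (IsNorthEastOccurrence π c j)
    isNorthEastOccurrence-invariant π c j f g e (inc , ok , iso' , adj' , cell' , right , above) =
      (λ a b lt → subst₂ F._<_ (e a) (e b) (inc a b lt)) ,
      (λ a → subst₂ _≡_ (cong (lookup π) (e a)) (cong just (ev a)) (ok a)) ,
      (λ a b → subst₂ (λ x y → (x < y) ⇔ (perm σ a F.< perm σ b)) (ev a) (ev b) (iso' a b)) ,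
      (λ h m → subst₂ (λ x y → toℕ x ≡ suc (toℕ y)) (e (F.suc h)) (e (inject₁ h)) (adj' h m)) ,
      (λ a → subst₂ (λ x y → x < col B y) (ev a) (e (fromℕ (m σ))) (cell' a)) ,
      (λ a → subst (c F.<_) (e a) (right a)) ,
      (λ a → subst (j <_) (ev a) (above a))
      where
        ev : ∀ a → valueAt π f a ≡ valueAt π g a
        ev a = cong (fromMaybe 0 ∘ lookup π) (e a)

    toShadowed : ∀ π c j f → IsNorthEastOccurrence π c j f → Shadowed π c j
    toShadowed π c j f (inc , ok , iso' , adj' , cell' , right , above) =
      record { pos = f ; pos-inc = inc ; val = valueAt π f ; val-ok = ok
             ; iso = iso' ; adj = adj' ; cell = cell' } , right , above

    fromShadowed : ∀ π c j → Shadowed π c j → Σ (Fin K → Fin N) (IsNorthEastOccurrence π c j)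
    fromShadowed π c j (O , right , above) =
      pos O , pos-inc O ,
      (λ a → trans (val-ok O a) (cong just (ev a))) ,
      (λ a b → subst₂ (λ x y → (x < y) ⇔ (perm σ a F.< perm σ b)) (ev a) (ev b) (iso O a b)) ,
      adj O ,
      (λ a → subst (λ x → x < col B (pos O (fromℕ (m σ)))) (ev a) (cell O a)) ,
      right ,
      (λ a → subst (j <_) (ev a) (above a))
      where
        ev : ∀ a → val O a ≡ valueAt π (pos O) a
        ev a = sym (cong (fromMaybe 0) (val-ok O a))

  opaque
    shadowed? : ∀ π c j → Dec (Shadowed π c j)
    shadowed? π c j = map′ (λ (f , p) → toShadowed π c j f p) (fromShadowed π c j)
                        (searchMaps K (IsNorthEastOccurrence π c j) (isNorthEastOccurrence-invariant π c j)
                                    (isNorthEastOccurrence? π c j))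
      where open Decide

  opaque
    shadowHeight : Word → Fin N → ℕ
    shadowHeight π c = prefixLength (shadowed? π c) (col B c)

    shadowHeight-sound : ∀ {π c j} → j < shadowHeight π c → Shadowed π c j
    shadowHeight-sound {π} {c} {j} = prefixLength-sound (shadowed? π c) (col B c) j

    shadowHeight-complete : ∀ {π c j} → Shadowed π c j → j < shadowHeight π c
    shadowHeight-complete {π} {c} {j} s =
      prefixLength-complete (shadowed? π c) (λ i≤j s' → shadowed-down s' Fₚ.≤-refl i≤j)
                            (col B c) j (shadowed-inBoard s) s

    shadowHeight-cong : ∀ π π' → (∀ c j → Shadowed π c j → Shadowed π' c j) →
                        (∀ c j → Shadowed π' c j → Shadowed π c j) → ∀ c → shadowHeight π c ≡ shadowHeight π' c
    shadowHeight-cong π π' f g c = prefixLength-cong (shadowed? π c) (shadowed? π' c) (col B c) (f c) (g c)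

  shadowHeight-decreasing : ∀ π (c d : Fin N) → c F.≤ d → shadowHeight π d ≤ shadowHeight π c
  shadowHeight-decreasing π c d c≤d with shadowHeight π d ≤? shadowHeight π c
  ... | yes le = le
  ... | no ≰ = ⊥-elim (ℕₚ.<-irrefl refl
                 (shadowHeight-complete (shadowed-down (shadowHeight-sound {π} {d} (ℕₚ.≰⇒> ≰)) c≤d ℕₚ.≤-refl)))

  heights : Word → Vec ℕ N
  heights π = tabulate (shadowHeight π)

  heights-decreasing : ∀ π → True (decreasing? (heights π))
  heights-decreasing π = fromWitness λ c d le →
    subst₂ _≤_ (sym (Vₚ.lookup∘tabulate (shadowHeight π) d)) (sym (Vₚ.lookup∘tabulate (shadowHeight π) c))
           (shadowHeight-decreasing π c d le)

  shadowBoard : Word → Board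
  shadowBoard π = boardOf (heights π) (heights-decreasing π)

  AgreeOutside : Word → Word → Set
  AgreeOutside π π' = ∀ c r → ¬ Shadowed π c r →
                      (lookup π c ≡ just r → lookup π' c ≡ just r) × (lookup π' c ≡ just r → lookup π c ≡ just r)

  WitnessedOutside : Word → Fin N → ℕ → Set
  WitnessedOutside π c j = Σ (Occurrence B π σ) λ O → NorthEastOf O c j × (∀ a → ¬ Shadowed π (pos O a) (val O a))

  -- If an occurrence witnessing (c , j) has a shadowed entry, pass to an occurrence
  -- shadowing that entry; it is again north-east of (c , j).  Each step raises the row
  -- while staying in the board, so after col B c steps an unshadowed witness is reached.
  witnessedOutside : ∀ π fuel c j → col B c ≤ j + fuel → Shadowed π c j → WitnessedOutside π c j
  witnessedOutside π zero c j le s =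
    ⊥-elim (ℕₚ.<-irrefl refl (ℕₚ.<-≤-trans (shadowed-inBoard s) (subst (col B c ≤_) (ℕₚ.+-identityʳ j) le)))
  witnessedOutside π (suc fuel) c j le (O , right , above) with Fₚ.any? (λ a → shadowed? π (pos O a) (val O a))
  ... | no ¬s = O , (right , above) , λ a s → ¬s (a , s)
  ... | yes (a , s) with witnessedOutside π fuel (pos O a) (val O a) le' s
    where
      le' : col B (pos O a) ≤ val O a + fuel
      le' = ℕₚ.≤-trans (col-dec B c (pos O a) (ℕₚ.<⇒≤ (right a)))
              (ℕₚ.≤-trans le (subst (_≤ val O a + fuel) (sym (ℕₚ.+-suc j fuel)) (ℕₚ.+-monoˡ-≤ fuel (above a))))
  ... | O' , (right' , above') , outside =
        O' , ((λ b → ℕₚ.<-trans (right a) (right' b)) , (λ b → ℕₚ.<-trans (above a) (above' b))) , outside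

  shadow-preserved : ∀ {π π'} → AgreeOutside π π' → ∀ c j → Shadowed π c j → Shadowed π' c j
  shadow-preserved {π} agree c j s with witnessedOutside π (col B c) c j (ℕₚ.m≤n+m (col B c) j) s
  ... | O , ne , outside =
        transport-occurrence O (λ a → proj₁ (agree (pos O a) (val O a) (outside a)) (val-ok O a)) , ne

  shadow-reflected : ∀ {π π'} → AgreeOutside π π' → ∀ c j → Shadowed π' c j → Shadowed π c j
  shadow-reflected {π} agree c j (O , right , above) with Fₚ.any? (λ a → shadowed? π (pos O a) (val O a))
  ... | yes (a , s) = shadowed-down s (ℕₚ.<⇒≤ (right a)) (ℕₚ.<⇒≤ (above a))
  ... | no ¬s = transport-occurrence O (λ a → proj₂ (agree (pos O a) (val O a) (λ s → ¬s (a , s))) (val-ok O a))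
              , right , above

  shadowHeight-agree : ∀ {π π'} → AgreeOutside π π' → ∀ c → shadowHeight π c ≡ shadowHeight π' c
  shadowHeight-agree agree = shadowHeight-cong _ _ (shadow-preserved agree) (shadow-reflected agree)

  heights-agree : ∀ {π π'} → AgreeOutside π π' → heights π ≡ heights π'
  heights-agree agree = Vₚ.tabulate-cong (shadowHeight-agree agree)

  restrictEntry : Word → Fin N → Maybe ℕ → Maybe ℕ
  restrictEntry π c nothing = nothing
  restrictEntry π c (just r) with shadowed? π c r
  ... | yes _ = just (suc r)
  ... | no _  = nothing

  RestrictedFrom : Word → Fin N → ℕ → Set
  RestrictedFrom π c x = Σ ℕ λ r → (x ≡ suc r) × (lookup π c ≡ just r) × Shadowed π c r

  opaque
    restrict : Word → Word
    restrict π = tabulate (λ c → restrictEntry π c (lookup π c))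

    restrict-shadowed : ∀ {π c r} → lookup π c ≡ just r → Shadowed π c r → lookup (restrict π) c ≡ just (suc r)
    restrict-shadowed {π} {c} {r} e s
      rewrite Vₚ.lookup∘tabulate (λ c → restrictEntry π c (lookup π c)) c | e with shadowed? π c r
    ... | yes _ = refl
    ... | no ¬s = ⊥-elim (¬s s)

    restrict-unshadowed : ∀ {π c r} → lookup π c ≡ just r → ¬ Shadowed π c r → lookup (restrict π) c ≡ nothing
    restrict-unshadowed {π} {c} {r} e ¬s
      rewrite Vₚ.lookup∘tabulate (λ c → restrictEntry π c (lookup π c)) c | e with shadowed? π c r
    ... | yes s = ⊥-elim (¬s s)
    ... | no _  = refl

    restrict-empty : ∀ {π c} → lookup π c ≡ nothing → lookup (restrict π) c ≡ nothing
    restrict-empty {π} {c} e rewrite Vₚ.lookup∘tabulate (λ c → restrictEntry π c (lookup π c)) c | e = refl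

    restrict-origin : ∀ {π c x} → lookup (restrict π) c ≡ just x → RestrictedFrom π c x
    restrict-origin {π} {c} {x} e rewrite Vₚ.lookup∘tabulate (λ c → restrictEntry π c (lookup π c)) c
      with lookup π c in eq
    ... | just r with shadowed? π c r
    restrict-origin refl | just r | yes s = r , refl , refl , s

  restrict-removed : ∀ {π c} → lookup (restrict π) c ≡ nothing → ∀ r → lookup π c ≡ just r → ¬ Shadowed π c r
  restrict-removed e r e' s with () ← trans (sym (restrict-shadowed e' s)) e

-- The board is
-- taken as boardOf w for any vector w of the shadow heights (so that it applies to
-- every filling with the same shadow).
module Split (σ : Pattern) (B : Board) (τ : Pattern) where
  open Shadow σ B
  open SumIndex (m τ) (m σ)

  a = m τ
  b = m σ

  module _ (π : Word) (w : Vec ℕ N) (ok : True (decreasing? w)) (w≡h : ∀ c → lookup w c ≡ shadowHeight π c) where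
    G = boardOf w ok

    -- Forward: the σ-part of an occurrence of τ ⊕ σ shadows all entries of the τ-part,
    -- so the τ-part survives in π⁺.
    module Forward (O : Occurrence B π (τ ⊕ σ)) where
      σ-part : Occurrence B π σ
      σ-part = record
        { pos     = λ y → pos O (R y)
        ; pos-inc = λ x y lt → pos-inc O (R x) (R y) (from (R<R x y) lt)
        ; val     = λ y → val O (R y)
        ; val-ok  = λ y → val-ok O (R y)
        ; iso     = λ x y → mk⇔
            (λ l → to (R<R _ _) (subst₂ F._<_ (perm-R (perm τ) (perm σ) x) (perm-R (perm τ) (perm σ) y)
                                   (to (iso O (R x) (R y)) l)))
            (λ r → from (iso O (R x) (R y)) (subst₂ F._<_ (sym (perm-R (perm τ) (perm σ) x))
                                   (sym (perm-R (perm τ) (perm σ) y)) (from (R<R _ _) r)))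
        ; adj     = λ g mem → subst (λ q → toℕ (pos O (R (F.suc g))) ≡ suc (toℕ (pos O q))) (inject-gapR g)
                       (adj O (a ↑ʳ F.suc g) (Vₚ.lookup⇒[]= _ _ (trans (gaps-R (gaps τ) false (gaps σ) g)
                                                                         (Vₚ.[]=⇒lookup mem))))
        ; cell    = λ y → subst (λ z → val O (R y) < col B (pos O z)) last≡lastR (cell O (R y))
        }

      shadowed-τ : ∀ x → Shadowed π (pos O (L (fromℕ a))) (val O (L x))
      shadowed-τ x = σ-part , (λ y → pos-inc O (L (fromℕ a)) (R y) (L<R _ y)) ,
        (λ y → from (iso O (L x) (R y)) (subst₂ F._<_ (sym (perm-L (perm τ) (perm σ) x))
                                          (sym (perm-R (perm τ) (perm σ) y)) (L<R _ _)))

      τ-part : Occurrence G (restrict π) τ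
      τ-part = record
        { pos     = λ x → pos O (L x)
        ; pos-inc = λ x y lt → pos-inc O (L x) (L y) (from (L<L x y) lt)
        ; val     = λ x → suc (val O (L x))
        ; val-ok  = λ x → restrict-shadowed (val-ok O (L x))
                            (shadowed-down (shadowed-τ x) (pos-mono O (L x) _ (L≤lastL x)) ℕₚ.≤-refl)
        ; iso     = λ x y → mk⇔
            (λ l → to (L<L _ _) (subst₂ F._<_ (perm-L (perm τ) (perm σ) x) (perm-L (perm τ) (perm σ) y)
                                   (to (iso O (L x) (L y)) (s≤s⁻¹ l))))
            (λ r → s≤s (from (iso O (L x) (L y)) (subst₂ F._<_ (sym (perm-L (perm τ) (perm σ) x))
                                   (sym (perm-L (perm τ) (perm σ) y)) (from (L<L _ _) r))))
        ; adj     = λ g mem → subst (λ q → toℕ (pos O (L (F.suc g))) ≡ suc (toℕ (pos O q))) (inject-gapL g)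
                       (adj O (g ↑ˡ suc b) (Vₚ.lookup⇒[]= _ _ (trans (gaps-L (gaps τ) false (gaps σ) g)
                                                                        (Vₚ.[]=⇒lookup mem))))
        ; cell    = λ x → s≤s (subst (val O (L x) <_) (sym (w≡h _)) (shadowHeight-complete (shadowed-τ x)))
        }

    restrict-contains : Occurrence B π (τ ⊕ σ) → Occurrence G (restrict π) τ
    restrict-contains = Forward.τ-part

    -- Backward: an occurrence of τ in π⁺ comes from shadowed entries of π; the σ-occurrence
    -- shadowing its highest entry, at its last column, completes it to τ ⊕ σ.
    module Backward (O : Occurrence G (restrict π) τ) where
      origin : ∀ x → RestrictedFrom π (pos O x) (val O x)
      origin x = restrict-origin (val-ok O x)

      v : Fin (suc a) → ℕ
      v x = proj₁ (origin x)

      val≡suc-v : ∀ x → val O x ≡ suc (v x)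
      val≡suc-v x = proj₁ (proj₂ (origin x))

      v-ok : ∀ x → lookup π (pos O x) ≡ just (v x)
      v-ok x = proj₁ (proj₂ (proj₂ (origin x)))

      top : Fin (suc a)
      top = proj₁ (argmax v)

      v≤top : ∀ x → v x ≤ v top
      v≤top = proj₂ (argmax v)

      lastColumn = pos O (fromℕ a)

      top-shadowed : Shadowed π lastColumn (v top)
      top-shadowed = shadowHeight-sound (subst (v top <_) (w≡h lastColumn)
                       (s≤s⁻¹ (subst (_< suc (lookup w lastColumn)) (val≡suc-v top) (cell O top))))

    module Glue (O : Occurrence G (restrict π) τ) (v : Fin (suc a) → ℕ)
                (val≡suc-v : ∀ x → val O x ≡ suc (v x)) (v-ok : ∀ x → lookup π (pos O x) ≡ just (v x))
                (top : Fin (suc a)) (v≤top : ∀ x → v x ≤ v top) (Oσ : Occurrence B π σ)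
                (right : ∀ y → pos O (fromℕ a) F.< pos Oσ y) (above : ∀ y → v top < val Oσ y) where

      position : Fin (suc a + suc b) → Fin N
      position z = [ pos O , pos Oσ ]′ (splitAt (suc a) z)
      value : Fin (suc a + suc b) → ℕ
      value z = [ v , val Oσ ]′ (splitAt (suc a) z)

      position-L : ∀ x → position (L x) ≡ pos O x
      position-L x rewrite Fₚ.splitAt-↑ˡ (suc a) x (suc b) = refl
      position-R : ∀ y → position (R y) ≡ pos Oσ y
      position-R y rewrite Fₚ.splitAt-↑ʳ (suc a) (suc b) y = refl
      value-L : ∀ x → value (L x) ≡ v x
      value-L x rewrite Fₚ.splitAt-↑ˡ (suc a) x (suc b) = refl
      value-R : ∀ y → value (R y) ≡ val Oσ y
      value-R y rewrite Fₚ.splitAt-↑ʳ (suc a) (suc b) y = refl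

      τ<σ : ∀ x y → v x < val Oσ y
      τ<σ x y = ℕₚ.≤-<-trans (v≤top x) (above y)

      position-inc : ∀ z z' → z F.< z' → position z F.< position z'
      position-inc z z' lt with view z | view z'
      ... | isL x | isL y rewrite position-L x | position-L y = pos-inc O x y (to (L<L x y) lt)
      ... | isL x | isR y rewrite position-L x | position-R y =
            ℕₚ.≤-<-trans (pos-mono O x (fromℕ a) (Fₚ.≤fromℕ x)) (right y)
      ... | isR y | isL x = ⊥-elim (R≮L x y lt)
      ... | isR x | isR y rewrite position-R x | position-R y = pos-inc Oσ x y (to (R<R x y) lt)

      value-ok : ∀ z → lookup π (position z) ≡ just (value z)
      value-ok z with view z
      ... | isL x rewrite position-L x | value-L x = v-ok x
      ... | isR y rewrite position-R y | value-R y = val-ok Oσ y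

      value-iso : ∀ z z' → (value z < value z') ⇔ (⊕-perm (perm τ) (perm σ) z F.< ⊕-perm (perm τ) (perm σ) z')
      value-iso z z' with view z | view z'
      ... | isL x | isL y rewrite value-L x | value-L y | perm-L (perm τ) (perm σ) x | perm-L (perm τ) (perm σ) y =
            mk⇔ (λ l → from (L<L _ _) (to (iso O x y) (subst₂ _<_ (sym (val≡suc-v x)) (sym (val≡suc-v y)) (s≤s l))))
                (λ r → s≤s⁻¹ (subst₂ _<_ (val≡suc-v x) (val≡suc-v y) (from (iso O x y) (to (L<L _ _) r))))
      ... | isL x | isR y rewrite value-L x | value-R y | perm-L (perm τ) (perm σ) x | perm-R (perm τ) (perm σ) y =
            mk⇔ (λ _ → L<R _ _) (λ _ → τ<σ x y)
      ... | isR y | isL x rewrite value-L x | value-R y | perm-L (perm τ) (perm σ) x | perm-R (perm τ) (perm σ) y =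
            mk⇔ (λ l → ⊥-elim (ℕₚ.<-asym l (τ<σ x y))) (λ r → ⊥-elim (R≮L _ _ r))
      ... | isR x | isR y rewrite value-R x | value-R y | perm-R (perm τ) (perm σ) x | perm-R (perm τ) (perm σ) y =
            mk⇔ (λ l → from (R<R _ _) (to (iso Oσ x y) l)) (λ r → from (iso Oσ x y) (to (R<R _ _) r))

      position-adj : ∀ (g : Fin (a + suc b)) → g ∈ gaps (τ ⊕ σ) →
                     toℕ (position (F.suc g)) ≡ suc (toℕ (position (inject₁ g)))
      position-adj g mem with gapView g
      ... | gapL g' = subst₂ (λ q q' → toℕ q ≡ suc (toℕ q')) (sym (position-L (F.suc g')))
                        (sym (trans (cong position (inject-gapL g')) (position-L (inject₁ g'))))
                        (adj O g' (Vₚ.lookup⇒[]= _ _ (trans (sym (gaps-L (gaps τ) false (gaps σ) g')) (Vₚ.[]=⇒lookup mem))))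
      ... | gapJoin with () ← trans (sym (gaps-join (gaps τ) false (gaps σ))) (Vₚ.[]=⇒lookup mem)
      ... | gapR g' = subst₂ (λ q q' → toℕ q ≡ suc (toℕ q')) (sym (position-R (F.suc g')))
                        (sym (trans (cong position (inject-gapR g')) (position-R (inject₁ g'))))
                        (adj Oσ g' (Vₚ.lookup⇒[]= _ _ (trans (sym (gaps-R (gaps τ) false (gaps σ) g')) (Vₚ.[]=⇒lookup mem))))

      value-cell : ∀ z → value z < col B (position (fromℕ (a + suc b)))
      value-cell z rewrite last≡lastR | position-R (fromℕ b) with view z
      ... | isL x rewrite value-L x = ℕₚ.<-trans (τ<σ x (fromℕ b)) (cell Oσ (fromℕ b))
      ... | isR y rewrite value-R y = cell Oσ y

      glued : Occurrence B π (τ ⊕ σ)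
      glued = record { pos = position ; pos-inc = position-inc ; val = value ; val-ok = value-ok
                     ; iso = value-iso ; adj = position-adj ; cell = value-cell }

    contains-restrict : Occurrence G (restrict π) τ → Occurrence B π (τ ⊕ σ)
    contains-restrict O = Glue.glued O v val≡suc-v v-ok top v≤top Oσ right above
      where
        open Backward O
        Oσ    = proj₁ top-shadowed
        right = proj₁ (proj₂ top-shadowed)
        above = proj₂ (proj₂ top-shadowed)

Avoiders : (G : Board) → Subset (n G) → Subset (height G) → Pattern → Set
Avoiders G C R p = Setoid.Carrier (AvoidingFillings G C R p)

Transform : Pattern → Pattern → Set
Transform p q = ∀ G C R → Avoiders G C R p → Avoiders G C R q

RespectsWords : ∀ {p q} → Transform p q → Set
RespectsWords f = ∀ G C R (x y : Avoiders G C R _) → proj₁ x ≡ proj₁ y → proj₁ (f G C R x) ≡ proj₁ (f G C R y)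

transform-on-equal-boards : ∀ {p q} (f : Transform p q) → RespectsWords f →
  ∀ {N} {w w' : Vec ℕ N} {ok : True (decreasing? w)} {ok' : True (decreasing? w')} → w ≡ w' →
  ∀ (ρ : Vec (Maybe ℕ) N) {C C' R R'} → C ≡ emptyColumns ρ → C' ≡ emptyColumns ρ →
  R ≡ emptyRows (boardOf w ok) ρ → R' ≡ emptyRows (boardOf w' ok') ρ →
  (u : Avoiders (boardOf w ok) C R p) (u' : Avoiders (boardOf w' ok') C' R' p) → proj₁ u ≡ proj₁ u' →
  proj₁ (f _ C R u) ≡ proj₁ (f _ C' R' u')
transform-on-equal-boards f f-resp {ok = ok} {ok'} refl ρ refl refl eR eR' u u' e
  with refl ← T-irrelevant ok ok' | refl ← eR | refl ← eR' = f-resp _ _ _ u u' e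

-- The entry of the replaced word: an entry ρ[c] = r + 1 of the new filling of the
-- (shifted) shadow board becomes r; where ρ is empty, π's entry is kept.
replaceEntry : Maybe ℕ → Maybe ℕ → Maybe ℕ
replaceEntry (just (suc r)) _ = just r
replaceEntry (just zero)    y = y
replaceEntry nothing        y = y

nothing≢just : ∀ {A : Set} {x : A} → nothing ≡ just x → ⊥
nothing≢just ()

module Exchange (σ : Pattern) (B : Board) (τ₁ τ₂ : Pattern) where
  open Shadow σ B
  module Split₁ = Split σ B τ₁
  module Split₂ = Split σ B τ₂

  module Restriction (C : Subset N) (R : Subset (height B)) (π : Word) (fill : IsFilling B π)
                     (ec : EmptyColsExactly B π C) (er : EmptyRowsExactly B π R) (av : ¬ Contains B π (τ₁ ⊕ σ)) where
    G  = shadowBoard π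
    π⁺ = restrict π
    C⁺ = emptyColumns π⁺
    R⁺ = emptyRows G π⁺

    heights≡h : ∀ c → lookup (heights π) c ≡ shadowHeight π c
    heights≡h = Vₚ.lookup∘tabulate (shadowHeight π)

    fill⁺ : IsFilling G π⁺
    fill⁺ = record
      { inBoard   = λ c x e → inBoard c x (restrict-origin e)
      ; rowUnique = λ c d x e e' → rowUnique c d x (restrict-origin e) (restrict-origin e') }
      where
        inBoard : ∀ c x → RestrictedFrom π c x → x < suc (lookup (heights π) c)
        inBoard c .(suc r) (r , refl , _ , s) = s≤s (subst (r <_) (sym (heights≡h c)) (shadowHeight-complete s))
        rowUnique : ∀ c d x → RestrictedFrom π c x → RestrictedFrom π d x → c ≡ d
        rowUnique c d .(suc r) (r , refl , e , _) (r' , refl , e' , _) = IsFilling.rowUnique fill c d r e e'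

    restricted : Avoiders G C⁺ R⁺ τ₁
    restricted = π⁺ , fill⁺ , emptyColumns-exact G π⁺ , emptyRows-exact G π⁺
               , av ∘ Split₁.contains-restrict π (heights π) (heights-decreasing π) heights≡h

    module Replace (ρ : Word) (fillρ : IsFilling G ρ) (ecρ : EmptyColsExactly G ρ C⁺)
                   (erρ : EmptyRowsExactly G ρ R⁺) (avρ : ¬ Contains G ρ τ₂) where
      π' : Word
      π' = tabulate (λ c → replaceEntry (lookup ρ c) (lookup π c))

      π'-lookup : ∀ c → lookup π' c ≡ replaceEntry (lookup ρ c) (lookup π c)
      π'-lookup c = Vₚ.lookup∘tabulate (λ c → replaceEntry (lookup ρ c) (lookup π c)) c

      ρ-empty⇒π⁺-empty : ∀ c → lookup ρ c ≡ nothing → lookup π⁺ c ≡ nothing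
      ρ-empty⇒π⁺-empty c e = to (emptyColumns-exact G π⁺ c) (from (ecρ c) e)
      π⁺-empty⇒ρ-empty : ∀ c → lookup π⁺ c ≡ nothing → lookup ρ c ≡ nothing
      π⁺-empty⇒ρ-empty c e = to (ecρ c) (from (emptyColumns-exact G π⁺ c) e)

      ρ-rows⇒π⁺-rows : ∀ x → Occupied ρ x → Occupied π⁺ x
      ρ-rows⇒π⁺-rows = sameEmptyRows-occupied G ρ π⁺ R⁺ fillρ erρ (emptyRows-exact G π⁺)
      π⁺-rows⇒ρ-rows : ∀ x → Occupied π⁺ x → Occupied ρ x
      π⁺-rows⇒ρ-rows = sameEmptyRows-occupied G π⁺ ρ R⁺ fill⁺ (emptyRows-exact G π⁺) erρ

      -- Row 0 of G is empty in π⁺, hence in ρ.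
      ρ-not-row0 : ∀ c → lookup ρ c ≢ just 0
      ρ-not-row0 c e with ρ-rows⇒π⁺-rows 0 (c , e)
      ... | d , e' with restrict-origin e'
      ... | _ , () , _

      -- An entry r + 1 of ρ is inside the board, so (c , r) is shadowed in π.
      ρ-shadowed : ∀ c r → lookup ρ c ≡ just (suc r) → Shadowed π c r
      ρ-shadowed c r e = shadowHeight-sound (subst (r <_) (heights≡h c) (s≤s⁻¹ (IsFilling.inBoard fillρ c (suc r) e)))

      data Source (c : Fin N) : Set where
        fromρ : ∀ r → lookup ρ c ≡ just (suc r) → lookup π' c ≡ just r → Source c
        fromπ : lookup ρ c ≡ nothing → lookup π' c ≡ lookup π c → lookup π⁺ c ≡ nothing → Source c

      source : ∀ c → Source c
      source c with lookup ρ c in eq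
      ... | just (suc r) = fromρ r eq (trans (π'-lookup c) (cong (λ z → replaceEntry z (lookup π c)) eq))
      ... | just zero    = ⊥-elim (ρ-not-row0 c eq)
      ... | nothing      = fromπ eq (trans (π'-lookup c) (cong (λ z → replaceEntry z (lookup π c)) eq))
                                 (ρ-empty⇒π⁺-empty c eq)

      agree : AgreeOutside π π'
      agree c r ¬s = (λ e → keep e (source c)) , (λ e → back e (source c))
        where
          keep : lookup π c ≡ just r → Source c → lookup π' c ≡ just r
          keep e (fromρ r' eρ _) = ⊥-elim (nothing≢just (trans (sym (π⁺-empty⇒ρ-empty c (restrict-unshadowed e ¬s))) eρ))
          keep e (fromπ _ e' _)  = trans e' e
          back : lookup π' c ≡ just r → Source c → lookup π c ≡ just r
          back e (fromρ r' eρ e') with refl ← just-injective (trans (sym e') e) = ⊥-elim (¬s (ρ-shadowed c r' eρ))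
          back e (fromπ _ e' _)  = trans (sym e') e

      heights-preserved : heights π ≡ heights π'
      heights-preserved = heights-agree agree

      -- π' has restriction ρ: this is what makes the construction invertible.
      restrict-π' : restrict π' ≡ ρ
      restrict-π' = vec-ext _ _ λ c → entry c (source c)
        where
          entry : ∀ c → Source c → lookup (restrict π') c ≡ lookup ρ c
          entry c (fromρ r eρ e') = trans (restrict-shadowed e' (shadow-preserved agree c r (ρ-shadowed c r eρ))) (sym eρ)
          entry c (fromπ eρ e' eπ⁺) with lookup π c in eq
          ... | nothing = trans (restrict-empty e') (sym eρ)
          ... | just r  = trans (restrict-unshadowed e' (λ s → restrict-removed eπ⁺ r eq (shadow-reflected agree c r s)))
                                (sym eρ)

      -- A row used by ρ in column c and by π outside the shadow in column d: impossible,
      -- since the row of ρ is also used by π⁺, i.e. by π inside the shadow.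
      no-row-clash : ∀ c d r → lookup ρ c ≡ just (suc r) → lookup π d ≡ just r → lookup π⁺ d ≡ nothing → ⊥
      no-row-clash c d r eρ eπ eπ⁺ with ρ-rows⇒π⁺-rows (suc r) (c , eρ)
      ... | c₂ , e₂ with restrict-origin {π} {c₂} {suc r} e₂
      ... | r₂ , refl , e₃ , s₃ with refl ← IsFilling.rowUnique fill c₂ d r₂ e₃ eπ = restrict-removed eπ⁺ r₂ eπ s₃

      fill' : IsFilling B π'
      fill' = record { inBoard   = λ c r e → inBoard c r e (source c)
                     ; rowUnique = λ c d r e e' → rowUnique c d r e e' (source c) (source d) }
        where
          inBoard : ∀ c r → lookup π' c ≡ just r → Source c → r < col B c
          inBoard c r e (fromρ r' eρ e') with refl ← just-injective (trans (sym e') e) = shadowed-inBoard (ρ-shadowed c r' eρ)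
          inBoard c r e (fromπ _ e' _) = IsFilling.inBoard fill c r (trans (sym e') e)
          rowUnique : ∀ c d r → lookup π' c ≡ just r → lookup π' d ≡ just r → Source c → Source d → c ≡ d
          rowUnique c d r e e' (fromρ r₁ eρ₁ e₁) (fromρ r₂ eρ₂ e₂)
            with refl ← just-injective (trans (sym e₁) e) | refl ← just-injective (trans (sym e₂) e') =
              IsFilling.rowUnique fillρ c d (suc r) eρ₁ eρ₂
          rowUnique c d r e e' (fromρ r₁ eρ₁ e₁) (fromπ _ e₂ eπ⁺) with refl ← just-injective (trans (sym e₁) e) =
            ⊥-elim (no-row-clash c d r eρ₁ (trans (sym e₂) e') eπ⁺)
          rowUnique c d r e e' (fromπ _ e₁ eπ⁺) (fromρ r₂ eρ₂ e₂) with refl ← just-injective (trans (sym e₂) e') =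
            ⊥-elim (no-row-clash d c r eρ₂ (trans (sym e₁) e) eπ⁺)
          rowUnique c d r e e' (fromπ _ e₁ _) (fromπ _ e₂ _) =
            IsFilling.rowUnique fill c d r (trans (sym e₁) e) (trans (sym e₂) e')

      ec' : EmptyColsExactly B π' C
      ec' c = mk⇔ (λ m → empty⇒ (to (ec c) m) (source c)) (λ e → from (ec c) (⇒empty e (source c)))
        where
          empty⇒ : lookup π c ≡ nothing → Source c → lookup π' c ≡ nothing
          empty⇒ e (fromρ r eρ _) = ⊥-elim (nothing≢just (trans (sym (π⁺-empty⇒ρ-empty c (restrict-empty e))) eρ))
          empty⇒ e (fromπ _ e' _) = trans e' e
          ⇒empty : lookup π' c ≡ nothing → Source c → lookup π c ≡ nothing
          ⇒empty e (fromρ r _ e') = ⊥-elim (nothing≢just (trans (sym e) e'))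
          ⇒empty e (fromπ _ e' _) = trans (sym e') e

      π-rows⇒π'-rows : ∀ x → Occupied π x → Occupied π' x
      π-rows⇒π'-rows x (c , e) with shadowed? π c x
      ... | no ¬s = c , proj₁ (agree c x ¬s) e
      ... | yes s with π⁺-rows⇒ρ-rows (suc x) (c , restrict-shadowed {π} {c} {x} e s)
      ... | d , eρ = d , entry (source d)
        where
          entry : Source d → lookup π' d ≡ just x
          entry (fromρ r eρ' e') with refl ← just-injective (trans (sym eρ') eρ) = e'
          entry (fromπ eρ' _ _) = ⊥-elim (nothing≢just (trans (sym eρ') eρ))

      π'-rows⇒π-rows : ∀ x → Occupied π' x → Occupied π x
      π'-rows⇒π-rows x (c , e) = row (source c)
        where
          row : Source c → Occupied π x
          row (fromρ r eρ e') with refl ← just-injective (trans (sym e') e) with ρ-rows⇒π⁺-rows (suc r) (c , eρ)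
          ... | d , e₂ with restrict-origin {π} {d} {suc r} e₂
          ... | _ , refl , e₃ , _ = d , e₃
          row (fromπ _ e' _) = c , trans (sym e') e

      er' : EmptyRowsExactly B π' R
      er' r = mk⇔ (λ m o → to (er r) m (π'-rows⇒π-rows _ o)) (λ ¬o → from (er r) (λ o → ¬o (π-rows⇒π'-rows _ o)))

      av' : ¬ Contains B π' (τ₂ ⊕ σ)
      av' O = avρ (subst (λ z → Contains G z τ₂) restrict-π'
                (Split₂.restrict-contains π' (heights π) (heights-decreasing π)
                   (λ c → trans (heights≡h c) (shadowHeight-agree agree c)) O))

      replaced : Avoiders B C R (τ₂ ⊕ σ)
      replaced = π' , fill' , ec' , er' , av'

      restore : ∀ c → replaceEntry (lookup π⁺ c) (lookup π' c) ≡ lookup π c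
      restore c with lookup π⁺ c in eq
      ... | just x with restrict-origin {π} {c} {x} eq
      ... | r , refl , e , _ = sym e
      restore c | nothing with source c
      ... | fromρ r eρ _  = ⊥-elim (nothing≢just (trans (sym (π⁺-empty⇒ρ-empty c eq)) eρ))
      ... | fromπ _ e' _  = e'

  induced : Transform τ₁ τ₂ → ∀ C R → Avoiders B C R (τ₁ ⊕ σ) → Avoiders B C R (τ₂ ⊕ σ)
  induced f C R (π , fill , ec , er , av) = replaceBy (f _ _ _ restricted)
    where
      open Restriction C R π fill ec er av
      replaceBy : Avoiders G C⁺ R⁺ τ₂ → Avoiders B C R (τ₂ ⊕ σ)
      replaceBy (ρ , fillρ , ecρ , erρ , avρ) = Replace.replaced ρ fillρ ecρ erρ avρ

  induced-respects : (f : Transform τ₁ τ₂) → RespectsWords f → ∀ C R (x x' : Avoiders B C R (τ₁ ⊕ σ)) →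
                     proj₁ x ≡ proj₁ x' → proj₁ (induced f C R x) ≡ proj₁ (induced f C R x')
  induced-respects f f-resp C R (π , fill , ec , er , av) (.π , fill' , ec' , er' , av') refl =
    cong (λ ρ → tabulate (λ c → replaceEntry (lookup ρ c) (lookup π c)))
         (f-resp _ _ _ (Restriction.restricted C R π fill ec er av) (Restriction.restricted C R π fill' ec' er' av') refl)

-- The replaced filling π' has the same shadow board as π and restriction f(π⁺), so g
-- returns π⁺ there, and replacing π⁺ back into π' restores π.
module RoundTrip (σ : Pattern) (B : Board) (τ₁ τ₂ : Pattern) (f : Transform τ₁ τ₂) (g : Transform τ₂ τ₁)
                 (g-resp : RespectsWords g)
                 (g-undoes-f : ∀ G C R (z : Avoiders G C R τ₁) (u : Avoiders G C R τ₂) →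
                               proj₁ u ≡ proj₁ (f G C R z) → proj₁ (g G C R u) ≡ proj₁ z) where
  module There = Exchange σ B τ₁ τ₂
  module Back  = Exchange σ B τ₂ τ₁

  induced-undone : ∀ C R (x : Avoiders B C R (τ₁ ⊕ σ)) →
                   proj₁ (Back.induced g C R (There.induced f C R x)) ≡ proj₁ x
  induced-undone C R (π , fill , ec , er , av) =
    trans (cong (λ ρ' → tabulate (λ c → replaceEntry (lookup ρ' c) (lookup π' c))) g-returns-π⁺)
          (vec-ext _ _ λ c → trans (Vₚ.lookup∘tabulate _ c) (restore c))
    where
      open There.Restriction C R π fill ec er av
      fρ = f G C⁺ R⁺ restricted
      ρ  = proj₁ fρ
      open Replace ρ (proj₁ (proj₂ fρ)) (proj₁ (proj₂ (proj₂ fρ)))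
                   (proj₁ (proj₂ (proj₂ (proj₂ fρ)))) (proj₂ (proj₂ (proj₂ (proj₂ fρ))))
      module Again = Back.Restriction C R π' fill' ec' er' av'

      -- On the shadow board of π' (equal to that of π), g sees the word ρ = f(π⁺).
      g-returns-π⁺ : proj₁ (g Again.G Again.C⁺ Again.R⁺ Again.restricted) ≡ π⁺
      g-returns-π⁺ = trans
        (transform-on-equal-boards g g-resp (sym heights-preserved) ρ
           (cong emptyColumns restrict-π') (emptyColumns-unique G ρ C⁺ (proj₁ (proj₂ (proj₂ fρ))))
           (cong (emptyRows Again.G) restrict-π') (emptyRows-unique G ρ R⁺ (proj₁ (proj₂ (proj₂ (proj₂ fρ)))))
           Again.restricted fρ restrict-π')
        (g-undoes-f G C⁺ R⁺ restricted fρ refl)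

theorem2p1 : ∀ (α β σ : Pattern) → FillingShapeWilfEquiv α β → FillingShapeWilfEquiv (α ⊕ σ) (β ⊕ σ)
theorem2p1 α β σ α≅β B C R = record
  { to        = there
  ; from      = back
  ; to-cong   = λ {x} {y} → there-resp x y
  ; from-cong = λ {x} {y} → back-resp x y
  ; inverse   = (λ {x} {y} e → trans (there-resp y (back x) e) (there-after-back x))
              , (λ {x} {y} e → trans (back-resp y (there x) e) (back-after-there x))
  }
  where
    f : Transform α β
    f G C R = Inverse.to (α≅β G C R)
    g : Transform β α
    g G C R = Inverse.from (α≅β G C R)
    f-resp : RespectsWords f
    f-resp G C R _ _ = Inverse.to-cong (α≅β G C R)
    g-resp : RespectsWords g
    g-resp G C R _ _ = Inverse.from-cong (α≅β G C R)
    g-undoes-f : ∀ G C R (z : Avoiders G C R α) u → proj₁ u ≡ proj₁ (f G C R z) → proj₁ (g G C R u) ≡ proj₁ z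
    g-undoes-f G C R _ _ = Inverse.inverseʳ (α≅β G C R)
    f-undoes-g : ∀ G C R (z : Avoiders G C R β) u → proj₁ u ≡ proj₁ (g G C R z) → proj₁ (f G C R u) ≡ proj₁ z
    f-undoes-g G C R _ _ = Inverse.inverseˡ (α≅β G C R)

    there : Avoiders B C R (α ⊕ σ) → Avoiders B C R (β ⊕ σ)
    there = Exchange.induced σ B α β f C R
    back : Avoiders B C R (β ⊕ σ) → Avoiders B C R (α ⊕ σ)
    back = Exchange.induced σ B β α g C R
    there-resp : ∀ x y → proj₁ x ≡ proj₁ y → proj₁ (there x) ≡ proj₁ (there y)
    there-resp = Exchange.induced-respects σ B α β f f-resp C R
    back-resp : ∀ x y → proj₁ x ≡ proj₁ y → proj₁ (back x) ≡ proj₁ (back y)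
    back-resp = Exchange.induced-respects σ B β α g g-resp C R
    there-after-back : ∀ x → proj₁ (there (back x)) ≡ proj₁ x
    there-after-back = RoundTrip.induced-undone σ B β α g f f-resp f-undoes-g C R
    back-after-there : ∀ x → proj₁ (back (there x)) ≡ proj₁ x
    back-after-there = RoundTrip.induced-undone σ B α β f g g-resp g-undoes-f C R
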